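{- Let $D$ be an $n\times n$ distance matrix. If $\phi_1$ has a satisfying assignment $\mathbf{X}$ with $D(\phi_1,\mathbf{X})\ne D$, then there is no graph realisation $(G=(V,E),\Phi)$ of $D$ with $|V|=n+1$.
   Context: $[n]=\{1,\dots,n\}$. An $n\times n$ matrix $D$ with non-negative integer entries is a distance matrix if all diagonal entries are $0$, all off-diagonal entries are strictly positive, $D$ is symmetric, and $D_{iw}+D_{wj}\ge D_{ij}$ for all $i,j,w$. A graph realisation of $D$ is a pair $(G,\Phi)$ with $G=(V,E)$ a finite simple undirected unweighted graph and $\Phi:[n]\to V$ injective such that $d_G(\Phi(i),\Phi(j))=D_{ij}$ for all $i,j$ ($d_G$ the shortest-path distance). Let $G_D$ be the graph on $\{v_1,\dots,v_n\}$ with $\{v_i,v_j\}$ an edge iff $D_{ij}=1$, and $d_{G_D}$ its shortest-path distance. The 2-CNF formula $\phi_1$ has boolean variables $x_{i,n+1}$, $i\in[n]$, and is the conjunction of the following clauses: for all $i,j\in[n]$ with $D_{ij}>2$, the clause $(\bar x_{i,n+1}\lor\bar x_{j,n+1})$; for all $i,j\in[n]$ with $D_{ij}=2$ and $d_{G_D}(v_i,v_j)>2$, the clauses $(x_{i,n+1}\lor x_{i,n+1})$ and $(x_{j,n+1}\lor x_{j,n+1})$. For a satisfying assignment $\mathbf{X}$ of $\phi_1$, let $G_{\phi_1,\mathbf{X}}$ be the graph on $\{v_1,\dots,v_{n+1}\}$ whose induced subgraph on $v_1,\dots,v_n$ is $G_D$ and in which $v_{n+1}$ is adjacent to $v_i$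 ($i\in[n]$) iff $x_{i,n+1}$ is true under $\mathbf{X}$; $D(\phi_1,\mathbf{X})$ is the $n\times n$ matrix of shortest-path distances in $G_{\phi_1,\mathbf{X}}$ between $v_1,\dots,v_n$. -}

module Defs where

open import Data.Nat using (ℕ; zero; suc; _<_; _>_; _≤_)
open import Data.Nat using (_≡ᵇ_)
open import Data.Fin using (Fin; zero; suc)
open import Data.Bool using (Bool; true; false; not; _∨_)
open import Data.Maybe using (Maybe; just; nothing)
import Data.Maybe as Maybe
open import Data.Product using (Σ; _×_; ∃-syntax)
open import Relation.Binary.PropositionalEquality using (_≡_; _≢_)
open import Relation.Nullary using (¬_)
open import Function.Definitions using (Injective)

Adjacency : ℕ → Set
Adjacency m = Fin m → Fin m → Bool

data Walk {m : ℕ} (A : Adjacency m) : ℕ → Fin m → Fin m → Set where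
  here : ∀ {u} → Walk A 0 u u
  step : ∀ {k u w v} → A u w ≡ true → Walk A k w v → Walk A (suc k) u v

-- Shortest-path distance: d_A(u,v) = k (a walk of length k, none shorter).
-- If no walk exists, no k satisfies this (distance is infinite).
IsDist : ∀ {m} → Adjacency m → Fin m → Fin m → ℕ → Set
IsDist A u v k = Walk A k u v × (∀ j → j < k → ¬ Walk A j u v)

DistGt2 : ∀ {m} → Adjacency m → Fin m → Fin m → Set
DistGt2 A u v = ∀ j → j ≤ 2 → ¬ Walk A j u v

record SimpleGraph (m : ℕ) : Set where
  field
    adj   : Adjacency m
    sym   : ∀ u v → adj u v ≡ adj v u
    irrefl : ∀ v → adj v v ≡ false
open SimpleGraph public

Matrix : ℕ → Set
Matrix n = Fin n → Fin n → ℕ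

record IsDistanceMatrix {n : ℕ} (D : Matrix n) : Set where
  field
    diag  : ∀ i → D i i ≡ 0
    pos   : ∀ i j → i ≢ j → D i j > 0
    symm  : ∀ i j → D i j ≡ D j i
    tri   : ∀ i j w → D i j ≤ D i w Data.Nat.+ D w j

IsRealisation : ∀ {n m} → Matrix n → SimpleGraph m → (Fin n → Fin m) → Set
IsRealisation D G Φ = Injective _≡_ _≡_ Φ × (∀ i j → IsDist (adj G) (Φ i) (Φ j) (D i j))

GD : ∀ {n} → Matrix n → Adjacency n
GD D i j = D i j ≡ᵇ 1

-- Assignment of the variables x_{i,n+1}
Assignment : ℕ → Set
Assignment n = Fin n → Bool

Satisfies-φ₁ : ∀ {n} → Matrix n → Assignment n → Set
Satisfies-φ₁ D X =
  (∀ i j → D i j > 2 → (not (X i) ∨ not (X j)) ≡ true)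
  × (∀ i j → D i j ≡ 2 → DistGt2 (GD D) i j →
       ((X i ∨ X i) ≡ true) × ((X j ∨ X j) ≡ true))

-- Vertex v_{n+1} is the last element of Fin (suc n); v_i (i ∈ [n]) is inject₁ i.
-- toOld maps inject₁ i ↦ just i and the last vertex ↦ nothing.
toOld : ∀ {n} → Fin (suc n) → Maybe (Fin n)
toOld {zero} zero = nothing
toOld {suc n} zero = just zero
toOld {suc n} (suc i) = Maybe.map suc (toOld i)

Gφ₁X-adj : ∀ {n} → Matrix n → Assignment n → Adjacency (suc n)
Gφ₁X-adj D X u v with toOld u | toOld v
... | just i  | just j  = GD D i j
... | just i  | nothing = X i
... | nothing | just j  = X j
... | nothing | nothing = false

Dφ₁X≡D : ∀ {n} → Matrix n → Assignment n → Set
Dφ₁X≡D {n} D X = ∀ i j →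
  IsDist (Gφ₁X-adj D X) (Data.Fin.inject₁ i) (Data.Fin.inject₁ j) (D i j)

{-# OPTIONS --safe #-}
module Submission where

-- If (G, Φ) realises D on n + 1 vertices, Φ misses at most one vertex of G.
-- Walks in G_{φ₁,X} are never shorter than D: an edge of G_D has D-length 1, and a
-- detour through v_{n+1} joins two vertices whose variables are true, which the
-- clauses for D_ij > 2 force to be at D-distance at most 2. Conversely, a geodesic of G
-- between image vertices meets the image at least every second step, and each segment
-- has D-length 1 or 2: length 1 is an edge of G_D, length 2 is a common neighbour in
-- G_D or, failing one, the clauses for d_{G_D} > 2 make v_{n+1} adjacent to both ends.
-- So D(φ₁,X) = D for every satisfying X.

open import Defs hiding (sym)
open import Data.Nat using (ℕ; suc; zero; _≤_; _+_; s≤s; _≤?_)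
open import Data.Nat.Properties
  using (≤-trans; ≤-reflexive; ≤-antisym; +-mono-≤; +-monoˡ-≤; +-monoʳ-≤; +-cancelˡ-≤; +-cancelʳ-≤;
         <⇒≱; ≰⇒>; ≡ᵇ⇒≡; ≡⇒≡ᵇ; 1+n≰n)
open import Data.Fin using (Fin; zero; suc; inject₁; fromℕ; _≟_)
open import Data.Fin.Properties using (any?; injective⇒≤; inject₁-injective; fromℕ≢inject₁)
open import Data.Bool using (true; false; not; _∨_)
open import Data.Bool.Properties using (∨-idem; T-≡) renaming (_≟_ to _≟ᵇ_)
open import Data.Maybe using (just; nothing)
open import Data.Product using (_×_; ∃; ∃-syntax; _,_; proj₁; proj₂)
open import Function.Bundles using (Equivalence)
open import Function.Definitions using (Injective)
open import Relation.Nullary using (¬_; yes; no; contradiction)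
open import Relation.Nullary.Decidable using (_×-dec_)
open import Relation.Binary.PropositionalEquality

_++ʷ_ : ∀ {m} {A : Adjacency m} {k l u v w} → Walk A k u v → Walk A l v w → Walk A (k + l) u w
here       ++ʷ q = q
step e p   ++ʷ q = step e (p ++ʷ q)

+-squeeze : ∀ {x y s t} → x ≤ s → y ≤ t → s + t ≤ x + y → x ≡ s × y ≡ t
+-squeeze {x} {y} {s} {t} x≤s y≤t s+t≤x+y =
  ≤-antisym x≤s (+-cancelʳ-≤ t s x (≤-trans s+t≤x+y (+-monoʳ-≤ x y≤t))) ,
  ≤-antisym y≤t (+-cancelˡ-≤ s t y (≤-trans s+t≤x+y (+-monoˡ-≤ y x≤s)))

module _ {n} {f : Fin n → Fin (suc n)} (f-inj : Injective _≡_ _≡_ f) where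

  injective⇒atMostOneMissed : ∀ {u v} → ¬ ∃ (λ i → f i ≡ u) → ¬ ∃ (λ i → f i ≡ v) → u ≡ v
  injective⇒atMostOneMissed {u} {v} u∉ v∉ with u ≟ v
  ... | yes u≡v = u≡v
  ... | no u≢v = contradiction (injective⇒≤ g-inj) 1+n≰n
    where
    g : Fin (suc (suc n)) → Fin (suc n)
    g zero          = u
    g (suc zero)    = v
    g (suc (suc i)) = f i

    g-inj : Injective _≡_ _≡_ g
    g-inj {zero}        {zero}        _ = refl
    g-inj {zero}        {suc zero}    e = contradiction e u≢v
    g-inj {zero}        {suc (suc j)} e = contradiction (j , sym e) u∉
    g-inj {suc zero}    {zero}        e = contradiction (sym e) u≢v
    g-inj {suc zero}    {suc zero}    _ = refl
    g-inj {suc zero}    {suc (suc j)} e = contradiction (j , sym e) v∉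
    g-inj {suc (suc i)} {zero}        e = contradiction (i , e) u∉
    g-inj {suc (suc i)} {suc zero}    e = contradiction (i , e) v∉
    g-inj {suc (suc i)} {suc (suc j)} e = cong (λ i → suc (suc i)) (f-inj e)

module Realisation {n m} {D : Matrix n} (tri : ∀ i j w → D i j ≤ D i w + D w j)
                   (G : SimpleGraph m) {Φ : Fin n → Fin m} (real : IsRealisation D G Φ) where

  walk⇒D≤ : ∀ {k a b} → Walk (adj G) k (Φ a) (Φ b) → D a b ≤ k
  walk⇒D≤ {k} {a} {b} w with D a b ≤? k
  ... | yes D≤k = D≤k
  ... | no D≰k = contradiction w (proj₂ (proj₂ real a b) k (≰⇒> D≰k))

  geodesic-split : ∀ {s t a b c} → Walk (adj G) s (Φ a) (Φ c) → Walk (adj G) t (Φ c) (Φ b) →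
                   D a b ≡ s + t → D a c ≡ s × D c b ≡ t
  geodesic-split {a = a} {b} {c} p q D≡ =
    +-squeeze (walk⇒D≤ p) (walk⇒D≤ q) (subst (_≤ D a c + D c b) D≡ (tri a b c))

data Vertex {n} : Fin (suc n) → Set where
  old : (i : Fin n) → Vertex (inject₁ i)
  new : Vertex (fromℕ n)

vertex : ∀ {n} (u : Fin (suc n)) → Vertex u
vertex {zero}  zero    = new
vertex {suc n} zero    = old zero
vertex {suc n} (suc u) with vertex u
... | old i = old (suc i)
... | new   = new

toOld-inject₁ : ∀ {n} (i : Fin n) → toOld (inject₁ i) ≡ just i
toOld-inject₁ {suc n} zero    = refl
toOld-inject₁ {suc n} (suc i) rewrite toOld-inject₁ i = refl

toOld-fromℕ : ∀ n → toOld (fromℕ n) ≡ nothing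
toOld-fromℕ zero    = refl
toOld-fromℕ (suc n) rewrite toOld-fromℕ n = refl

module _ {n} (D : Matrix n) where

  GD-edge⇒≡1 : ∀ {i j} → GD D i j ≡ true → D i j ≡ 1
  GD-edge⇒≡1 e = ≡ᵇ⇒≡ _ 1 (Equivalence.from T-≡ e)

  ≡1⇒GD-edge : ∀ {i j} → D i j ≡ 1 → GD D i j ≡ true
  ≡1⇒GD-edge D≡1 = Equivalence.to T-≡ (≡⇒≡ᵇ _ 1 D≡1)

  module _ (X : Assignment n) where

    edge-old-old : ∀ i j → Gφ₁X-adj D X (inject₁ i) (inject₁ j) ≡ GD D i j
    edge-old-old i j rewrite toOld-inject₁ i | toOld-inject₁ j = refl

    edge-old-new : ∀ i → Gφ₁X-adj D X (inject₁ i) (fromℕ n) ≡ X i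
    edge-old-new i rewrite toOld-inject₁ i | toOld-fromℕ n = refl

    edge-new-old : ∀ j → Gφ₁X-adj D X (fromℕ n) (inject₁ j) ≡ X j
    edge-new-old j rewrite toOld-inject₁ j | toOld-fromℕ n = refl

    edge-new-new : Gφ₁X-adj D X (fromℕ n) (fromℕ n) ≡ false
    edge-new-new rewrite toOld-fromℕ n = refl

module _ {n} {D : Matrix n} (dm : IsDistanceMatrix D) {X : Assignment n} (sat : Satisfies-φ₁ D X) where
  open IsDistanceMatrix dm

  private
    Gφ₁X : Adjacency (suc n)
    Gφ₁X = Gφ₁X-adj D X

  X-true⇒D≤2 : ∀ a c → X a ≡ true → X c ≡ true → D a c ≤ 2
  X-true⇒D≤2 a c Xa Xc with D a c ≤? 2
  ... | yes D≤2 = D≤2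
  ... | no D≰2 = contradiction (proj₁ sat a c (≰⇒> D≰2))
                   (subst₂ (λ p q → (not p ∨ not q) ≢ true) (sym Xa) (sym Xc) λ ())

  Gφ₁X-walk⇒D≤ : ∀ {k u v a b} → Walk Gφ₁X k u v → u ≡ inject₁ a → v ≡ inject₁ b → D a b ≤ k
  Gφ₁X-walk⇒D≤ {a = a} here refl a≡b with inject₁-injective a≡b
  ... | refl = ≤-reflexive (diag a)
  Gφ₁X-walk⇒D≤ {a = a} {b} (step {w = w} e rest) refl v≡b with vertex w
  ... | old c = ≤-trans (tri a b c)
                  (+-mono-≤ (≤-reflexive (GD-edge⇒≡1 D (trans (sym (edge-old-old D X a c)) e)))
                            (Gφ₁X-walk⇒D≤ rest refl v≡b))
  ... | new with rest
  ...   | here = contradiction v≡b fromℕ≢inject₁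
  ...   | step {w = w′} e′ rest′ with vertex w′
  ...     | new   = contradiction (trans (sym e′) (edge-new-new D X)) λ ()
  ...     | old c = ≤-trans (tri a b c)
                      (+-mono-≤ (X-true⇒D≤2 a c (trans (sym (edge-old-new D X a)) e)
                                                (trans (sym (edge-new-old D X c)) e′))
                                (Gφ₁X-walk⇒D≤ rest′ refl v≡b))

  D≡2⇒walk : ∀ a c → D a c ≡ 2 → Walk Gφ₁X 2 (inject₁ a) (inject₁ c)
  D≡2⇒walk a c D≡2 with any? (λ m → (GD D a m ≟ᵇ true) ×-dec (GD D m c ≟ᵇ true))
  ... | yes (m , e , e′) =
    step (trans (edge-old-old D X a m) e) (step (trans (edge-old-old D X m c) e′) here)
  ... | no no-middle =
    step (trans (edge-old-new D X a) (trans (sym (∨-idem _)) (proj₁ X-both)))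
         (step (trans (edge-new-old D X c) (trans (sym (∨-idem _)) (proj₂ X-both))) here)
    where
    far : DistGt2 (GD D) a c
    far 0 _ here                    = contradiction (trans (sym (diag a)) D≡2) λ ()
    far 1 _ (step e here)           = contradiction (trans (sym (GD-edge⇒≡1 D e)) D≡2) λ ()
    far 2 _ (step e (step e′ here)) = no-middle (_ , e , e′)
    far (suc (suc (suc _))) (s≤s (s≤s ())) _

    X-both : (X a ∨ X a) ≡ true × (X c ∨ X c) ≡ true
    X-both = proj₂ sat a c D≡2 far

  module _ (G : SimpleGraph (suc n)) {Φ : Fin n → Fin (suc n)} (real : IsRealisation D G Φ) where
    open Realisation tri G real using (geodesic-split)

    geodesic⇒Gφ₁X-walk : ∀ {k u b a} → Walk (adj G) k u (Φ b) → u ≡ Φ a → D a b ≡ k →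
                         Walk Gφ₁X k (inject₁ a) (inject₁ b)
    geodesic⇒Gφ₁X-walk here Φb≡Φa _ with proj₁ real Φb≡Φa
    ... | refl = here
    geodesic⇒Gφ₁X-walk {b = b} {a} (step {k = k} {w = w} e rest) refl D≡ with any? (λ c → Φ c ≟ w)
    ... | yes (c , refl) = step (trans (edge-old-old D X a c) (≡1⇒GD-edge D (proj₁ split)))
                                (geodesic⇒Gφ₁X-walk rest refl (proj₂ split))
      where
      split : D a c ≡ 1 × D c b ≡ k
      split = geodesic-split (step e here) rest D≡
    ... | no w∉ with rest
    ...   | here = contradiction (b , refl) w∉
    ...   | step {k = k′} {w = w′} e′ rest′ with any? (λ c → Φ c ≟ w′)
    ...     | no w′∉ =
      contradiction (trans (sym (irrefl G w)) (subst (λ x → adj G w x ≡ true) w′≡w e′)) λ ()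
      where
      w′≡w : w′ ≡ w
      w′≡w = injective⇒atMostOneMissed (proj₁ real) w′∉ w∉
    ...     | yes (c , refl) =
      D≡2⇒walk a c (proj₁ split) ++ʷ geodesic⇒Gφ₁X-walk rest′ refl (proj₂ split)
      where
      split : D a c ≡ 2 × D c b ≡ k′
      split = geodesic-split (step e (step e′ here)) rest′ D≡

proposition9 : (n : ℕ) (D : Matrix n) → IsDistanceMatrix D →
    (X : Assignment n) → Satisfies-φ₁ D X → ¬ Dφ₁X≡D D X →
    ¬ (∃[ G ] ∃[ Φ ] IsRealisation {n} {suc n} D G Φ)
proposition9 n D dm X sat D≢ (G , Φ , real) = D≢ λ i j →
  geodesic⇒Gφ₁X-walk dm sat G real (proj₁ (proj₂ real i j)) refl refl ,
  λ k k<D p → <⇒≱ k<D (Gφ₁X-walk⇒D≤ dm sat p refl refl)
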